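{- Let $(L,(W_t:t\in L))$ be a tidy line-decomposition of a graph $G$ such that for some $m$, every split has size at least $m$. Let $S$ be a split of size $m$, and let $\mathcal I$ be the set of all initial intervals $I$ such that $S$ is the $I$-split. Then either $\bigcap_{I\in\mathcal I}I=\emptyset$ and $S$ is the set of all left-limit vertices of $(L,(W_t:t\in L))$, or $\bigcap_{I\in\mathcal I}I$ is the minimal member of $\mathcal I$. Similarly, either $\bigcup_{I\in\mathcal I}I=L$ and $S$ is the set of all right-limit vertices, or $\bigcup_{I\in\mathcal I}I$ is the maximal member of $\mathcal I$.
   Context: Graphs may be infinite. A line is a nonempty set $L$ with a linear order $\le_L$. A line-decomposition of $G$ is a pair $(L,(W_t:t\in L))$ with $L$ a line and $W_t\subseteq V(G)$, such that $G=\bigcup_{t\in L}G[W_t]$ and $W_t\cap W_{t''}\subseteq W_{t'}$ whenever $t\le_L t'\le_L t''$; its width is the maximum of $|W_t|-1$ if it exists, and $\infty$ otherwise. It is tidy if $G$ is non-null, the width is finite, $W_s\not\subseteq W_t$ for all distinct $s,t\in L$, and each $W_t$ is a clique of $G$. An interval of $L$ is a nonempty $I\subseteq L$ such that $r\le_L s\le_L t$ and $r,t\in I$ imply $s\in I$; it is initial if $I\ne L$ and $s\le_L t$, $t\in I$ imply $s\in I$. Write $W(I)=\bigcup_{t\in I}W_t$. For an initial interval $I$, the $I$-split is $W(I)\cap W(L\setminus I)$; a split is a set that is the $I$-split for some initial interval $I$. A vertex $v$ is a left-limit vertex of the line-decomposition if for all $s\le_L t$, $v\in W_t$ implies $v\in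 W_s$; it is a right-limit vertex if for all $s\le_L t$, $v\in W_s$ implies $v\in W_t$. -}

module Defs where

open import Level using (Level; 0ℓ)
open import Data.Nat using (ℕ) renaming (_≤_ to _≤ℕ_)
open import Data.Fin using (Fin)
open import Data.Product using (Σ; ∃; _×_; _,_)
open import Relation.Nullary using (¬_)
open import Relation.Unary using (Pred; _∈_; _⊆_; _≐_)
open import Relation.Binary using (Rel; IsTotalOrder; Symmetric)
open import Relation.Binary.PropositionalEquality using (_≡_; _≢_)
open import Function.Definitions using (Injective)

private variable
  ℓ ℓ' : Level

HasSize : {A : Set} → Pred A ℓ → ℕ → Set ℓ
HasSize {A = A} S n =
  Σ (Fin n → A) λ f → Injective _≡_ _≡_ f × (∀ i → f i ∈ S) × (∀ a → a ∈ S → ∃ λ i → f i ≡ a)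

AtLeast : {A : Set} → Pred A ℓ → ℕ → Set ℓ
AtLeast {A = A} S m = Σ (Fin m → A) λ f → Injective _≡_ _≡_ f × (∀ i → f i ∈ S)

record Graph : Set₁ where
  field
    V      : Set
    E      : Rel V 0ℓ
    sym    : Symmetric E
    irrefl : ∀ {v} → ¬ E v v

record Line : Set₁ where
  field
    L            : Set
    _≤_          : Rel L 0ℓ
    isTotalOrder : IsTotalOrder _≡_ _≤_
    point        : L          -- a line is nonempty

module _ (G : Graph) (Λ : Line) where
  open Graph G
  open Line Λ

  IsInterval : Pred L ℓ → Set ℓ
  IsInterval I = (∃ λ t → I t) × (∀ r s t → r ≤ s → s ≤ t → I r → I t → I s)

  IsInitial : Pred L ℓ → Set ℓ
  IsInitial I = IsInterval I × ¬ (∀ t → I t) × (∀ s t → s ≤ t → I t → I s)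

  module _ (W : L → Pred V 0ℓ) where

    IsLineDecomposition : Set
    IsLineDecomposition =
      (∀ v → ∃ λ t → W t v) ×
      (∀ u v → E u v → ∃ λ t → W t u × W t v) ×
      (∀ t t' t'' → t ≤ t' → t' ≤ t'' → ∀ v → W t v → W t'' v → W t' v)

    FiniteWidth : Set
    FiniteWidth = ∃ λ k → ∀ t → ∃ λ n → n ≤ℕ k × HasSize (W t) n

    IsTidy : Set
    IsTidy =
      IsLineDecomposition ×
      (∃ λ (v : V) → v ≡ v) ×                           -- G is non-null
      FiniteWidth ×
      (∀ s t → s ≢ t → ¬ (W s ⊆ W t)) ×
      (∀ t u v → W t u → W t v → u ≢ v → E u v)

    WU : Pred L ℓ → Pred V ℓ
    WU I v = ∃ λ t → I t × W t v

    ISplit : Pred L ℓ → Pred V ℓ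
    ISplit I v = WU I v × WU (λ t → ¬ I t) v

    IsSplit : Pred V ℓ → Set (Level.suc 0ℓ Level.⊔ ℓ)
    IsSplit S = ∃ λ (I : Pred L 0ℓ) → IsInitial I × S ≐ ISplit I

    InFamily : Pred V ℓ' → Pred L ℓ → Set (ℓ Level.⊔ ℓ')
    InFamily S I = IsInitial I × S ≐ ISplit I

    ⋂Family : Pred V ℓ' → Pred L (Level.suc 0ℓ Level.⊔ ℓ')
    ⋂Family S t = ∀ (I : Pred L 0ℓ) → InFamily S I → I t

    ⋃Family : Pred V ℓ' → Pred L (Level.suc 0ℓ Level.⊔ ℓ')
    ⋃Family S t = ∃ λ (I : Pred L 0ℓ) → InFamily S I × I t

    LeftLimit : Pred V 0ℓ
    LeftLimit v = ∀ s t → s ≤ t → W t v → W s v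

    RightLimit : Pred V 0ℓ
    RightLimit v = ∀ s t → s ≤ t → W s v → W t v

{-# OPTIONS --safe #-}
-- Since every split has at least m = |S| vertices, an initial interval whose split is contained
-- in S has split exactly S.  The intersection (union) of the family, when it is a nonempty
-- (proper) initial interval, has its split inside S and therefore belongs to the family.
-- Otherwise every point of the line lies outside (inside) some member of the family, and
-- convexity of the bags makes S exactly the set of left-limit (right-limit) vertices.
module Submission where

open import Defs
open import Level using (Level; 0ℓ)
open import Data.Nat using (ℕ; suc)
open import Data.Nat.Properties using (n<1+n)
open import Data.Fin using (Fin; zero; suc)
open import Data.Fin.Properties using (<⇒notInjective)
open import Data.Vec.Functional using (_∷_)
open import Data.Product using (_×_; _,_; proj₁; proj₂; ∃)
open import Data.Sum using (_⊎_; inj₁; inj₂)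
open import Data.Empty using (⊥-elim)
open import Relation.Nullary using (¬_; yes; no)
open import Relation.Nullary.Decidable using (True; toWitness; fromWitness)
open import Relation.Unary using (Pred; _⊆_; _≐_)
open import Relation.Unary.Properties using (≐-sym)
open import Relation.Binary using (IsTotalOrder)
open import Relation.Binary.PropositionalEquality using (_≡_; refl; sym; trans; cong; subst)
open import Axiom.ExcludedMiddle using (ExcludedMiddle)
open import Axiom.DoubleNegationElimination using (em⇒dne)

private variable
  ℓ ℓ' : Level
  A : Set

AtLeast-mono : {P : Pred A ℓ} {Q : Pred A ℓ'} {m : ℕ} → P ⊆ Q → AtLeast P m → AtLeast Q m
AtLeast-mono P⊆Q (f , f-inj , f∈P) = f , f-inj , λ i → P⊆Q (f∈P i)

-- An element of S outside T would extend the enumeration of T to m + 1 distinct elements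
-- of S, whose indices in the enumeration of S give an injection Fin (suc m) → Fin m.
AtLeast⊆HasSize⇒¬¬⊇ : {S : Pred A ℓ} {T : Pred A ℓ'} {m : ℕ} →
                      HasSize S m → AtLeast T m → T ⊆ S → ∀ {s} → S s → ¬ ¬ T s
AtLeast⊆HasSize⇒¬¬⊇ {T = T} {m = m} (g , _ , _ , g-onto) (f , f-inj , f∈T) T⊆S {s} s∈S s∉T =
  <⇒notInjective (n<1+n m) index-inj
  where
  index : Fin (suc m) → Fin m
  index zero    = proj₁ (g-onto s s∈S)
  index (suc i) = proj₁ (g-onto (f i) (T⊆S (f∈T i)))

  g∘index : ∀ i → g (index i) ≡ (s ∷ f) i
  g∘index zero    = proj₂ (g-onto s s∈S)
  g∘index (suc i) = proj₂ (g-onto (f i) (T⊆S (f∈T i)))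

  same-element : ∀ {i j} → index i ≡ index j → (s ∷ f) i ≡ (s ∷ f) j
  same-element {i} {j} e = trans (sym (g∘index i)) (trans (cong g e) (g∘index j))

  index-inj : ∀ {i j} → index i ≡ index j → i ≡ j
  index-inj {zero}  {zero}  _ = refl
  index-inj {zero}  {suc j} e = ⊥-elim (s∉T (subst T (sym (same-element {zero} {suc j} e)) (f∈T j)))
  index-inj {suc i} {zero}  e = ⊥-elim (s∉T (subst T (same-element {suc i} {zero} e) (f∈T i)))
  index-inj {suc i} {suc j} e = cong suc (f-inj (same-element e))

AtLeast⊆HasSize⇒≐ : {S : Pred A ℓ} {T : Pred A ℓ'} {m : ℕ} → ExcludedMiddle ℓ' →
                    HasSize S m → AtLeast T m → T ⊆ S → S ≐ T
AtLeast⊆HasSize⇒≐ em |S|≡m |T|≥m T⊆S =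
  (λ s∈S → em⇒dne em (AtLeast⊆HasSize⇒¬¬⊇ |S|≡m |T|≥m T⊆S s∈S)) , T⊆S

¬∀⇒∃¬ : {B : A → Set ℓ} → (∀ {ℓ} → ExcludedMiddle ℓ) → ¬ (∀ x → B x) → ∃ λ x → ¬ B x
¬∀⇒∃¬ em ¬all = em⇒dne em λ none → ¬all λ x → em⇒dne em λ ¬Bx → none (x , ¬Bx)

module _ (G : Graph) (Λ : Line) where
  open Line Λ

  downset⇒IsInitial : {I : Pred L ℓ} → ∃ I → ¬ (∀ t → I t) → (∀ s t → s ≤ t → I t → I s) →
                      IsInitial G Λ I
  downset⇒IsInitial inhabited proper down =
    (inhabited , λ r s t _ s≤t _ It → down s t s≤t It) , proper , down

  IsInitial-resp-≐ : {I : Pred L ℓ} {J : Pred L ℓ'} → I ≐ J → IsInitial G Λ I → IsInitial G Λ J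
  IsInitial-resp-≐ (I⊆J , J⊆I) (((t , It) , _) , proper , down) =
    downset⇒IsInitial (t , I⊆J It) (λ all → proper (λ t → J⊆I (all t)))
                      (λ s t s≤t Jt → I⊆J (down s t s≤t (J⊆I Jt)))

  IsInitial⇒downward : {I : Pred L ℓ} → IsInitial G Λ I → ∀ s t → s ≤ t → I t → I s
  IsInitial⇒downward (_ , _ , down) = down

  IsInitial⇒≤ : {I : Pred L ℓ} → IsInitial G Λ I → ∀ {r s} → I r → ¬ I s → r ≤ s
  IsInitial⇒≤ (_ , _ , down) {r} {s} Ir s∉I with IsTotalOrder.total isTotalOrder r s
  ... | inj₁ r≤s = r≤s
  ... | inj₂ s≤r = ⊥-elim (s∉I (down s r s≤r Ir))

  module _ (W : L → Pred (Graph.V G) 0ℓ) where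

    ISplit-resp-≐ : {I : Pred L ℓ} {J : Pred L ℓ'} → I ≐ J → ISplit G Λ W I ⊆ ISplit G Λ W J
    ISplit-resp-≐ (I⊆J , J⊆I) ((r , Ir , Wr) , (t , t∉I , Wt)) =
      (r , I⊆J Ir , Wr) , (t , (λ Jt → t∉I (J⊆I Jt)) , Wt)

    module _ (S : Pred (Graph.V G) 0ℓ) where

      ⋂Family-initial : IsSplit G Λ W S → ∃ (⋂Family G Λ W S) → IsInitial G Λ (⋂Family G Λ W S)
      ⋂Family-initial (I₀ , I₀∈@((_ , proper , _) , _)) inhabited = downset⇒IsInitial inhabited
        (λ all → proper (λ t → all t I₀ I₀∈))
        (λ s t s≤t t∈⋂ I I∈ → IsInitial⇒downward (proj₁ I∈) s t s≤t (t∈⋂ I I∈))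

      ⋃Family-initial : IsSplit G Λ W S → ¬ (∀ t → ⋃Family G Λ W S t) →
                        IsInitial G Λ (⋃Family G Λ W S)
      ⋃Family-initial (I₀ , I₀∈@((((r , I₀r) , _) , _) , _)) proper =
        downset⇒IsInitial (r , I₀ , I₀∈ , I₀r) proper
          (λ { s t s≤t (I , I∈ , It) → I , I∈ , IsInitial⇒downward (proj₁ I∈) s t s≤t It })

      ISplit-⋃Family⊆ : ISplit G Λ W (⋃Family G Λ W S) ⊆ S
      ISplit-⋃Family⊆ ((r , (I , I∈@(_ , _ , split⊆S) , Ir) , Wr) , (t , t∉⋃ , Wt)) =
        split⊆S ((r , Ir , Wr) , (t , (λ It → t∉⋃ (I , I∈ , It)) , Wt))

      outside-family⇒S≐LeftLimit : IsLineDecomposition G Λ W →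
                                   (∀ t → ∃ λ (I : Pred L 0ℓ) → InFamily G Λ W S I × ¬ I t) →
                                   S ≐ LeftLimit G Λ W
      outside-family⇒S≐LeftLimit (covered , _ , convex) outside = S⊆left , left⊆S
        where
        S⊆left : S ⊆ LeftLimit G Λ W
        S⊆left {v} v∈S s t s≤t Wtv with outside s
        ... | I , (initial , S⊆split , _) , s∉I with S⊆split v∈S
        ... | (r , Ir , Wrv) , _ = convex r s t (IsInitial⇒≤ initial Ir s∉I) s≤t v Wrv Wtv

        left⊆S : LeftLimit G Λ W ⊆ S
        left⊆S {v} left with covered v
        ... | t , Wtv with outside t
        ... | I , (initial@(((r , Ir) , _) , _) , _ , split⊆S) , t∉I =
          split⊆S ((r , Ir , left r t (IsInitial⇒≤ initial Ir t∉I) Wtv) , (t , t∉I , Wtv))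

      module _ (em : ∀ {ℓ} → ExcludedMiddle ℓ) where

        ⋃Family-full⇒S≐RightLimit : IsLineDecomposition G Λ W →
                                    (∀ t → ⋃Family G Λ W S t) → S ≐ RightLimit G Λ W
        ⋃Family-full⇒S≐RightLimit (covered , _ , convex) inside = S⊆right , right⊆S
          where
          S⊆right : S ⊆ RightLimit G Λ W
          S⊆right {v} v∈S s t s≤t Wsv with inside t
          ... | I , (initial , S⊆split , _) , It with S⊆split v∈S
          ... | _ , (r , r∉I , Wrv) = convex s t r s≤t (IsInitial⇒≤ initial It r∉I) v Wsv Wrv

          right⊆S : RightLimit G Λ W ⊆ S
          right⊆S {v} right with covered v
          ... | t , Wtv with inside t
          ... | I , (initial@(_ , proper , _) , _ , split⊆S) , It with ¬∀⇒∃¬ em proper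
          ... | r , r∉I =
            split⊆S ((t , It , Wtv) , (r , r∉I , right t r (IsInitial⇒≤ initial It r∉I) Wtv))

        ∉⋂Family⇒∃∉ : ∀ {t} → ¬ ⋂Family G Λ W S t →
                      ∃ λ (I : Pred L 0ℓ) → InFamily G Λ W S I × ¬ I t
        ∉⋂Family⇒∃∉ t∉⋂ =
          em⇒dne em λ none → t∉⋂ λ I I∈ → em⇒dne em λ t∉I → none (I , I∈ , t∉I)

        ISplit-⋂Family⊆ : ISplit G Λ W (⋂Family G Λ W S) ⊆ S
        ISplit-⋂Family⊆ ((r , r∈⋂ , Wr) , (t , t∉⋂ , Wt)) with ∉⋂Family⇒∃∉ t∉⋂
        ... | I , I∈@(_ , _ , split⊆S) , t∉I = split⊆S ((r , r∈⋂ I I∈ , Wr) , (t , t∉I , Wt))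

        module _ {m : ℕ}
                 (splits-large : ∀ (I : Pred L 0ℓ) → IsInitial G Λ I → AtLeast (ISplit G Λ W I) m)
                 (|S|≡m : HasSize S m) where

          -- The hypothesis only covers level-0 intervals, so J is first replaced by a level-0 copy.
          ISplit⊆⇒InFamily : {J : Pred L ℓ} → IsInitial G Λ J → ISplit G Λ W J ⊆ S →
                             InFamily G Λ W S J
          ISplit⊆⇒InFamily {J = J} initial split⊆S =
            initial , AtLeast⊆HasSize⇒≐ em |S|≡m |split|≥m split⊆S
            where
            J₀ : Pred L 0ℓ
            J₀ t = True (em {P = J t})

            J≐J₀ : J ≐ J₀
            J≐J₀ = fromWitness , toWitness

            |split|≥m : AtLeast (ISplit G Λ W J) m
            |split|≥m = AtLeast-mono {P = ISplit G Λ W J₀} (ISplit-resp-≐ (≐-sym J≐J₀))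
                          (splits-large J₀ (IsInitial-resp-≐ J≐J₀ initial))

          ⋂Family-dichotomy : IsLineDecomposition G Λ W → IsSplit G Λ W S →
            ((∀ t → ¬ ⋂Family G Λ W S t) × S ≐ LeftLimit G Λ W)
            ⊎ (InFamily G Λ W S (⋂Family G Λ W S)
               × (∀ (I : Pred L 0ℓ) → InFamily G Λ W S I → ⋂Family G Λ W S ⊆ I))
          ⋂Family-dichotomy decomposition split with em {P = ∃ (⋂Family G Λ W S)}
          ... | no empty =
            inj₁ ( (λ t t∈⋂ → empty (t , t∈⋂))
                 , outside-family⇒S≐LeftLimit decomposition
                     (λ t → ∉⋂Family⇒∃∉ (λ t∈⋂ → empty (t , t∈⋂))))
          ... | yes inhabited =
            inj₂ ( ISplit⊆⇒InFamily (⋂Family-initial split inhabited) ISplit-⋂Family⊆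
                 , λ I I∈ t∈⋂ → t∈⋂ I I∈)

          ⋃Family-dichotomy : IsLineDecomposition G Λ W → IsSplit G Λ W S →
            ((∀ t → ⋃Family G Λ W S t) × S ≐ RightLimit G Λ W)
            ⊎ (InFamily G Λ W S (⋃Family G Λ W S)
               × (∀ (I : Pred L 0ℓ) → InFamily G Λ W S I → I ⊆ ⋃Family G Λ W S))
          ⋃Family-dichotomy decomposition split with em {P = ∀ t → ⋃Family G Λ W S t}
          ... | yes full = inj₁ (full , ⋃Family-full⇒S≐RightLimit decomposition full)
          ... | no proper =
            inj₂ ( ISplit⊆⇒InFamily (⋃Family-initial split proper) ISplit-⋃Family⊆
                 , λ I I∈ It → I , I∈ , It)

mainTheorem6 : (lem : ∀ {ℓ} → ExcludedMiddle ℓ)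
    → (G : Graph) (Λ : Line) (W : Line.L Λ → Pred (Graph.V G) 0ℓ)
    → IsTidy G Λ W
    → (m : ℕ)
    → (∀ (I : Pred (Line.L Λ) 0ℓ) → IsInitial G Λ I → AtLeast (ISplit G Λ W I) m)
    → (S : Pred (Graph.V G) 0ℓ)
    → IsSplit G Λ W S
    → HasSize S m
    → (((∀ t → ¬ ⋂Family G Λ W S t) × S ≐ LeftLimit G Λ W)
        ⊎ (InFamily G Λ W S (⋂Family G Λ W S)
           × (∀ (I : Pred (Line.L Λ) 0ℓ) → InFamily G Λ W S I → ⋂Family G Λ W S ⊆ I)))
      × (((∀ t → ⋃Family G Λ W S t) × S ≐ RightLimit G Λ W)
        ⊎ (InFamily G Λ W S (⋃Family G Λ W S)
           × (∀ (I : Pred (Line.L Λ) 0ℓ) → InFamily G Λ W S I → I ⊆ ⋃Family G Λ W S)))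
mainTheorem6 lem G Λ W (decomposition , _) m splits-large S split |S|≡m =
  ⋂Family-dichotomy G Λ W S lem splits-large |S|≡m decomposition split ,
  ⋃Family-dichotomy G Λ W S lem splits-large |S|≡m decomposition split
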